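{- Let $S$ be a $t$-conorm, $N$ a fuzzy negation and $T$ a $t$-norm, and let $I_{S,N,T}(x,y)=S(N(T(x,N(y))),N(x))$ for $x,y\in[0,1]$. Then: (i) $I_{S,N,T}$ satisfies (NP) if and only if $N$ is strong; (ii) if $N$ is strong then $I_{S,N,T}$ satisfies (CB); (iii) if $N$ is strong then $I_{S,N,T}$ satisfies (SIB); (iv) if $S=S_{max}$ (i.e. $S(x,y)=\max\{x,y\}$) or $N$ is crisp, then the natural negation of $I_{S,N,T}$ equals $N$, i.e. $I_{S,N,T}(x,0)=N(x)$ for all $x\in[0,1]$; (v) if $N$ is crisp then $I_{S,N,T}$ satisfies (IP); (vi) if $N$ is crisp then $I_{S,N,T}$ satisfies (LOP).
   Context: A $t$-norm is a function $T:[0,1]^2\to[0,1]$ that is commutative, associative, non-decreasing in each argument and satisfies $T(x,1)=x$. A $t$-conorm is a function $S:[0,1]^2\to[0,1]$ that is commutative, associative, non-decreasing in each argument and satisfies $S(x,0)=x$. A fuzzy negation is a non-increasing $N:[0,1]\to[0,1]$ with $N(0)=1$, $N(1)=0$; it is strong if $N(N(x))=x$ for all $x$, and crisp if $N(x)\in\{0,1\}$ for all $x$. For a function $I:[0,1]^2\to[0,1]$: (NP) means $I(1,y)=y$ for all $y$; (CB) means $y\le I(x,y)$ for all $x,y$; (SIB) means $I(x,I(x,y))\ge I(x,y)$ for all $x,y$; (IP) means $I(x,x)=1$ for all $x$; (LOP) means $x\le y$ implies $I(x,y)=1$. -}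

module Defs where

open import Level using (0ℓ)
open import Data.Product using (Σ; ∃; _×_; _,_)
open import Data.Sum using (_⊎_)
open import Relation.Nullary using (¬_)
open import Relation.Binary.PropositionalEquality using (_≡_)
open import Relation.Binary.Structures using (IsTotalOrder)
open import Algebra.Structures using (IsCommutativeRing)

-- The real numbers, axiomatised as a Dedekind-complete ordered field
-- (all such structures are isomorphic, so quantifying over them is the same
-- as speaking about ℝ).
record RealField : Set₁ where
  infixl 6 _+_
  infixl 7 _*_
  infix 4 _≤_
  field
    Carrier : Set
    _+_ _*_ : Carrier → Carrier → Carrier
    -_      : Carrier → Carrier
    0# 1#   : Carrier
    _≤_     : Carrier → Carrier → Set
    isCommutativeRing : IsCommutativeRing _≡_ _+_ _*_ -_ 0# 1#
    0≢1     : ¬ (0# ≡ 1#)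
    inverse : ∀ x → ¬ (x ≡ 0#) → ∃ λ y → x * y ≡ 1#
    isTotalOrder : IsTotalOrder _≡_ _≤_
    +-mono  : ∀ x y z → x ≤ y → x + z ≤ y + z
    *-pos   : ∀ x y → 0# ≤ x → 0# ≤ y → 0# ≤ x * y
    lub     : (P : Carrier → Set) → ∃ P → (∃ λ b → ∀ x → P x → x ≤ b) →
              ∃ λ s → (∀ x → P x → x ≤ s) × (∀ b → (∀ x → P x → x ≤ b) → s ≤ b)

module _ (R : RealField) where
  open RealField R

  In01 : Carrier → Set
  In01 x = (0# ≤ x) × (x ≤ 1#)

  -- Binary/unary operations on [0,1] are represented as functions on ℝ that
  -- map [0,1] into [0,1]; all axioms are required only on [0,1].
  Closed₂ : (Carrier → Carrier → Carrier) → Set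
  Closed₂ F = ∀ x y → In01 x → In01 y → In01 (F x y)

  Closed₁ : (Carrier → Carrier) → Set
  Closed₁ F = ∀ x → In01 x → In01 (F x)

  record IsTNorm (T : Carrier → Carrier → Carrier) : Set where
    field
      closed   : Closed₂ T
      comm     : ∀ x y → In01 x → In01 y → T x y ≡ T y x
      assoc    : ∀ x y z → In01 x → In01 y → In01 z → T x (T y z) ≡ T (T x y) z
      monoˡ    : ∀ x y z → In01 x → In01 y → In01 z → x ≤ y → T x z ≤ T y z
      monoʳ    : ∀ x y z → In01 x → In01 y → In01 z → y ≤ z → T x y ≤ T x z
      identity : ∀ x → In01 x → T x 1# ≡ x

  record IsTConorm (S : Carrier → Carrier → Carrier) : Set where
    field
      closed   : Closed₂ S
      comm     : ∀ x y → In01 x → In01 y → S x y ≡ S y x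
      assoc    : ∀ x y z → In01 x → In01 y → In01 z → S x (S y z) ≡ S (S x y) z
      monoˡ    : ∀ x y z → In01 x → In01 y → In01 z → x ≤ y → S x z ≤ S y z
      monoʳ    : ∀ x y z → In01 x → In01 y → In01 z → y ≤ z → S x y ≤ S x z
      identity : ∀ x → In01 x → S x 0# ≡ x

  record IsFuzzyNegation (N : Carrier → Carrier) : Set where
    field
      closed    : Closed₁ N
      antitone  : ∀ x y → In01 x → In01 y → x ≤ y → N y ≤ N x
      N0≡1      : N 0# ≡ 1#
      N1≡0      : N 1# ≡ 0#

  IsStrong : (Carrier → Carrier) → Set
  IsStrong N = ∀ x → In01 x → N (N x) ≡ x

  IsCrisp : (Carrier → Carrier) → Set
  IsCrisp N = ∀ x → In01 x → (N x ≡ 0#) ⊎ (N x ≡ 1#)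

  IsMax : Carrier → Carrier → Carrier → Set
  IsMax x y z = (x ≤ z) × (y ≤ z) × (∀ w → x ≤ w → y ≤ w → z ≤ w)

  IsSMax : (Carrier → Carrier → Carrier) → Set
  IsSMax S = ∀ x y → In01 x → In01 y → IsMax x y (S x y)

  I-SNT : (Carrier → Carrier → Carrier) → (Carrier → Carrier) →
          (Carrier → Carrier → Carrier) → Carrier → Carrier → Carrier
  I-SNT S N T x y = S (N (T x (N y))) (N x)

  NP : (Carrier → Carrier → Carrier) → Set
  NP I = ∀ y → In01 y → I 1# y ≡ y

  CB : (Carrier → Carrier → Carrier) → Set
  CB I = ∀ x y → In01 x → In01 y → y ≤ I x y

  SIB : (Carrier → Carrier → Carrier) → Set
  SIB I = ∀ x y → In01 x → In01 y → I x y ≤ I x (I x y)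

  IP : (Carrier → Carrier → Carrier) → Set
  IP I = ∀ x → In01 x → I x x ≡ 1#

  LOP : (Carrier → Carrier → Carrier) → Set
  LOP I = ∀ x y → In01 x → In01 y → x ≤ y → I x y ≡ 1#

  NaturalNegationIs : (Carrier → Carrier → Carrier) → (Carrier → Carrier) → Set
  NaturalNegationIs I N = ∀ x → In01 x → I x 0# ≡ N x

{-# OPTIONS --safe #-}
-- Substituting the boundary values 0 and 1 of T, S and N into I(x,y) = S(N(T(x,N y)),N x)
-- gives I(1,y) = N(N y) and I(x,0) = S(N x,N x), whence (i) and (iv), and I(x,y) = 1
-- as soon as N y = 0 or N x = 1, whence (v) and (vi) for crisp N. For strong N,
-- y = N(N y) ≤ N(T(x,N y)) ≤ I(x,y) gives (ii), and (iii) is (ii) at the point I(x,y).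
module Submission where

open import Defs
open import Algebra.Bundles using (CommutativeRing)
import Algebra.Properties.Ring as RingProperties
open import Data.Product using (_×_; _,_; proj₁; proj₂)
open import Data.Sum using (_⊎_; inj₁; inj₂)
open import Function.Bundles using (_⇔_; mk⇔)
open import Relation.Binary.Bundles using (Poset)
open import Relation.Binary.PropositionalEquality
  using (_≡_; refl; sym; trans; cong; cong₂; subst; subst₂; module ≡-Reasoning)
open import Relation.Binary.Structures using (IsTotalOrder)
import Relation.Binary.Reasoning.PartialOrder as PosetReasoning

module _ (R : RealField) where
  open RealField R
  open IsTotalOrder isTotalOrder using (total; antisym; reflexive)
    renaming (trans to ≤-trans)

  poset : Poset _ _ _
  poset = record { isPartialOrder = IsTotalOrder.isPartialOrder isTotalOrder }

  ≤-refl : ∀ {x} → x ≤ x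
  ≤-refl = reflexive refl

  -- If 1 ≤ 0 then 0 ≤ -1 by translation, and then 0 ≤ (-1)(-1) = 1.
  0≤1 : 0# ≤ 1#
  0≤1 with total 0# 1#
  ... | inj₁ 0≤1 = 0≤1
  ... | inj₂ 1≤0 = subst (0# ≤_) -1*-1≡1 (*-pos (- 1#) (- 1#) 0≤-1 0≤-1)
    where
    commutativeRing : CommutativeRing _ _
    commutativeRing = record { isCommutativeRing = isCommutativeRing }
    open CommutativeRing commutativeRing using (ring; -‿inverseʳ; +-identityˡ)
    open RingProperties ring using (-1*x≈-x; -‿involutive)

    -1*-1≡1 : - 1# * - 1# ≡ 1#
    -1*-1≡1 = trans (-1*x≈-x (- 1#)) (-‿involutive 1#)

    0≤-1 : 0# ≤ - 1#
    0≤-1 = subst₂ _≤_ (-‿inverseʳ 1#) (+-identityˡ (- 1#)) (+-mono 1# 0# (- 1#) 1≤0)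

  0∈[0,1] : In01 R 0#
  0∈[0,1] = ≤-refl , 0≤1

  1∈[0,1] : In01 R 1#
  1∈[0,1] = 0≤1 , ≤-refl

  module TNormProperties {T : Carrier → Carrier → Carrier} (isT : IsTNorm R T) where
    open IsTNorm isT

    identityˡ : ∀ y → In01 R y → T 1# y ≡ y
    identityˡ y y∈ = trans (comm 1# y 1∈[0,1] y∈) (identity y y∈)

    Txy≤y : ∀ x y → In01 R x → In01 R y → T x y ≤ y
    Txy≤y x y x∈ y∈ = begin
      T x y   ≤⟨ monoˡ x 1# y x∈ 1∈[0,1] y∈ (proj₂ x∈) ⟩
      T 1# y  ≡⟨ identityˡ y y∈ ⟩
      y       ∎
      where open PosetReasoning poset

    zeroʳ : ∀ x → In01 R x → T x 0# ≡ 0#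
    zeroʳ x x∈ = antisym (Txy≤y x 0# x∈ 0∈[0,1]) (proj₁ (closed x 0# x∈ 0∈[0,1]))

  module TConormProperties {S : Carrier → Carrier → Carrier} (isS : IsTConorm R S) where
    open IsTConorm isS

    x≤Sxy : ∀ x y → In01 R x → In01 R y → x ≤ S x y
    x≤Sxy x y x∈ y∈ = begin
      x       ≡⟨ identity x x∈ ⟨
      S x 0#  ≤⟨ monoʳ x 0# y x∈ 0∈[0,1] y∈ (proj₁ y∈) ⟩
      S x y   ∎
      where open PosetReasoning poset

    zeroˡ : ∀ y → In01 R y → S 1# y ≡ 1#
    zeroˡ y y∈ = antisym (proj₂ (closed 1# y 1∈[0,1] y∈)) (x≤Sxy 1# y 1∈[0,1] y∈)

    zeroʳ : ∀ x → In01 R x → S x 1# ≡ 1#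
    zeroʳ x x∈ = trans (comm x 1# x∈ 1∈[0,1]) (zeroˡ x x∈)

    idem-at-0-or-1 : ∀ x → x ≡ 0# ⊎ x ≡ 1# → S x x ≡ x
    idem-at-0-or-1 _ (inj₁ refl) = identity 0# 0∈[0,1]
    idem-at-0-or-1 _ (inj₂ refl) = zeroˡ 1# 1∈[0,1]

  IsSMax⇒idem : ∀ {S} → IsSMax R S → ∀ x → In01 R x → S x x ≡ x
  IsSMax⇒idem isMax x x∈ with isMax x x x∈ x∈
  ... | x≤Sxx , _ , least = antisym (least x ≤-refl ≤-refl) x≤Sxx

  CB⇒SIB : ∀ {I} → Closed₂ R I → CB R I → SIB R I
  CB⇒SIB closed cb x y x∈ y∈ = cb x _ x∈ (closed x y x∈ y∈)

  LOP⇒IP : ∀ {I} → LOP R I → IP R I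
  LOP⇒IP lop x x∈ = lop x x x∈ x∈ ≤-refl

  module ImplicationProperties
    {S : Carrier → Carrier → Carrier} {N : Carrier → Carrier} {T : Carrier → Carrier → Carrier}
    (isS : IsTConorm R S) (isN : IsFuzzyNegation R N) (isT : IsTNorm R T) where
    open IsFuzzyNegation isN renaming (closed to N-closed)
    module S = TConormProperties isS
    module T = TNormProperties isT

    I : Carrier → Carrier → Carrier
    I = I-SNT R S N T

    I-closed : Closed₂ R I
    I-closed x y x∈ y∈ = IsTConorm.closed isS _ _
      (N-closed _ (IsTNorm.closed isT x (N y) x∈ (N-closed y y∈))) (N-closed x x∈)

    I-1ˡ : ∀ y → In01 R y → I 1# y ≡ N (N y)
    I-1ˡ y y∈ = begin
      S (N (T 1# (N y))) (N 1#)  ≡⟨ cong₂ (λ u v → S (N u) v) (T.identityˡ (N y) (N-closed y y∈)) N1≡0 ⟩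
      S (N (N y)) 0#             ≡⟨ IsTConorm.identity isS (N (N y)) (N-closed _ (N-closed y y∈)) ⟩
      N (N y)                    ∎
      where open ≡-Reasoning

    I-0ʳ : ∀ x → In01 R x → I x 0# ≡ S (N x) (N x)
    I-0ʳ x x∈ = begin
      S (N (T x (N 0#))) (N x)  ≡⟨ cong (λ u → S (N (T x u)) (N x)) N0≡1 ⟩
      S (N (T x 1#)) (N x)      ≡⟨ cong (λ u → S (N u) (N x)) (IsTNorm.identity isT x x∈) ⟩
      S (N x) (N x)             ∎
      where open ≡-Reasoning

    N-y≡0⇒I≡1 : ∀ x y → In01 R x → N y ≡ 0# → I x y ≡ 1#
    N-y≡0⇒I≡1 x y x∈ Ny≡0 = begin
      S (N (T x (N y))) (N x)  ≡⟨ cong (λ u → S (N (T x u)) (N x)) Ny≡0 ⟩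
      S (N (T x 0#)) (N x)     ≡⟨ cong (λ u → S (N u) (N x)) (T.zeroʳ x x∈) ⟩
      S (N 0#) (N x)           ≡⟨ cong (λ u → S u (N x)) N0≡1 ⟩
      S 1# (N x)               ≡⟨ S.zeroˡ (N x) (N-closed x x∈) ⟩
      1#                       ∎
      where open ≡-Reasoning

    N-x≡1⇒I≡1 : ∀ x y → In01 R x → In01 R y → N x ≡ 1# → I x y ≡ 1#
    N-x≡1⇒I≡1 x y x∈ y∈ Nx≡1 = trans (cong (S _) Nx≡1)
      (S.zeroʳ _ (N-closed _ (IsTNorm.closed isT x (N y) x∈ (N-closed y y∈))))

    NP⇔IsStrong : NP R I ⇔ IsStrong R N
    NP⇔IsStrong = mk⇔ (λ np y y∈ → trans (sym (I-1ˡ y y∈)) (np y y∈))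
                      (λ strong y y∈ → trans (I-1ˡ y y∈) (strong y y∈))

    IsStrong⇒CB : IsStrong R N → CB R I
    IsStrong⇒CB strong x y x∈ y∈ = begin
      y                ≡⟨ strong y y∈ ⟨
      N (N y)          ≤⟨ antitone _ _ T∈ Ny∈ (T.Txy≤y x (N y) x∈ Ny∈) ⟩
      N (T x (N y))    ≤⟨ S.x≤Sxy _ (N x) (N-closed _ T∈) (N-closed x x∈) ⟩
      I x y            ∎
      where
      open PosetReasoning poset
      Ny∈ = N-closed y y∈
      T∈ = IsTNorm.closed isT x (N y) x∈ Ny∈

    naturalNegation : IsSMax R S ⊎ IsCrisp R N → NaturalNegationIs R I N
    naturalNegation h x x∈ = trans (I-0ʳ x x∈) (idem h)
      where
      idem : IsSMax R S ⊎ IsCrisp R N → S (N x) (N x) ≡ N x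
      idem (inj₁ isMax) = IsSMax⇒idem isMax (N x) (N-closed x x∈)
      idem (inj₂ crisp) = S.idem-at-0-or-1 (N x) (crisp x x∈)

    IsCrisp⇒LOP : IsCrisp R N → LOP R I
    IsCrisp⇒LOP crisp x y x∈ y∈ x≤y with crisp x x∈
    ... | inj₂ Nx≡1 = N-x≡1⇒I≡1 x y x∈ y∈ Nx≡1
    ... | inj₁ Nx≡0 = N-y≡0⇒I≡1 x y x∈
      (antisym (≤-trans (antitone x y x∈ y∈ x≤y) (reflexive Nx≡0)) (proj₁ (N-closed y y∈)))

proposition3p2 : (R : RealField) →
    let open RealField R in
    (S : Carrier → Carrier → Carrier) (N : Carrier → Carrier) (T : Carrier → Carrier → Carrier) →
    IsTConorm R S → IsFuzzyNegation R N → IsTNorm R T →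
    (NP R (I-SNT R S N T) ⇔ IsStrong R N)
    × (IsStrong R N → CB R (I-SNT R S N T))
    × (IsStrong R N → SIB R (I-SNT R S N T))
    × ((IsSMax R S ⊎ IsCrisp R N) → NaturalNegationIs R (I-SNT R S N T) N)
    × (IsCrisp R N → IP R (I-SNT R S N T))
    × (IsCrisp R N → LOP R (I-SNT R S N T))
proposition3p2 R S N T isS isN isT =
    NP⇔IsStrong
  , IsStrong⇒CB
  , (λ strong → CB⇒SIB R I-closed (IsStrong⇒CB strong))
  , naturalNegation
  , (λ crisp → LOP⇒IP R (IsCrisp⇒LOP crisp))
  , IsCrisp⇒LOP
  where open ImplicationProperties R isS isN isT
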